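{- Let $\sigma$ be any subsequence (possibly empty) of $e\,w_l\,w_r\,c$. Neither $\mathring{\mathbb{M}}^{sl}_\sigma$ nor $\mathring{\mathbb{M}}^{\ell}_\sigma$ is the equivalent algebraic semantics of any Hilbert system (in the respective language $\langle\vee,*,0,1\rangle$, resp. $\langle\vee,\wedge,*,0,1\rangle$).
   Context: For a subsequence $\sigma$ of $e\,w_l\,w_r\,c$ ($a\le b$ means $a\vee b=b$): $\mathring{\mathbb{M}}^{sl}_\sigma$ is the class of algebras $\langle A,\vee,*,0,1\rangle$ with $\langle A,\vee\rangle$ a join-semilattice, $\langle A,*,1\rangle$ a monoid, $*$ distributing over $\vee$ on both sides, $0$ an arbitrary element, and satisfying, for each letter in $\sigma$: $e$: $x*y=y*x$; $w_l$: $x\le 1$; $w_r$: $0\le x$; $c$: $x\le x*x$. $\mathring{\mathbb{M}}^{\ell}_\sigma$ is the class of algebras $\langle A,\vee,\wedge,*,0,1\rangle$ whose $\langle\vee,\wedge\rangle$-reduct is a lattice and whose $\langle\vee,*,0,1\rangle$-reduct lies in $\mathring{\mathbb{M}}^{sl}_\sigma$. A Hilbert system on a propositional language $\Psi$ is a substitution-invariant consequence relation $\vdash$ on $\Psi$-formulas. A class $\mathbb{K}$ of $\Psi$-algebras is the equivalent algebraic semantics of $\vdash$ (in the sense of Blok–Pigozzi) if there are translations $\tau$ from formulas to finite sets of $\Psi$-equations and $\rho$ from equations to finite sets of formulas, each given by a schema in variables, such that $\Gamma\vdash\varphi$ iff $\tau[\Gamma]\models_{\mathbb{K}}\tau(\varphi)$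 for all $\Gamma\cup\{\varphi\}$, and each equation $\varphi\approx\psi$ is $\models_{\mathbb{K}}$-interderivable with $\tau(\rho(\varphi\approx\psi))$; here $E\models_{\mathbb{K}}\varepsilon$ means every assignment into a member of $\mathbb{K}$ satisfying $E$ satisfies $\varepsilon$. -}

module Defs where

open import Level using (Level; _⊔_) renaming (zero to lzero; suc to lsuc)
open import Data.Nat using (ℕ)
open import Data.Bool using (Bool; true; false)
open import Data.Unit using (⊤; tt)
open import Data.Product using (Σ; _×_; _,_; ∃)
open import Data.List using (List; map)
open import Data.List.Membership.Propositional using (_∈_)
open import Relation.Binary.PropositionalEquality using (_≡_)

-- The subsequence σ of  e w_l w_r c.  Since the four letters are
-- distinct and order is fixed, a subsequence is exactly a choice of
-- which letters occur (16 possibilities, including the empty one).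

record Sig : Set where
  constructor mkSig
  field
    e wl wr c : Bool

data Lang : Set where
  sl lat : Lang

data Fm (V : Set) : Lang → Set where
  var  : ∀ {L} → V → Fm V L
  join : ∀ {L} → Fm V L → Fm V L → Fm V L
  meet : Fm V lat → Fm V lat → Fm V lat
  mul  : ∀ {L} → Fm V L → Fm V L → Fm V L
  zer  : ∀ {L} → Fm V L
  one  : ∀ {L} → Fm V L

subst : ∀ {L V W} → (V → Fm W L) → Fm V L → Fm W L
subst s (var x)    = s x
subst s (join a b) = join (subst s a) (subst s b)
subst s (meet a b) = meet (subst s a) (subst s b)
subst s (mul a b)  = mul (subst s a) (subst s b)
subst s zer        = zer
subst s one        = one

Form : Lang → Set
Form L = Fm ℕ L

Eqn : Lang → Set
Eqn L = Form L × Form L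

MeetOp : Lang → Set → Set
MeetOp sl  A = ⊤
MeetOp lat A = A → A → A

record Alg (L : Lang) : Set₁ where
  field
    Carrier : Set
    _∨_     : Carrier → Carrier → Carrier
    ∧op     : MeetOp L Carrier
    _*_     : Carrier → Carrier → Carrier
    𝟎 𝟏     : Carrier

eval : ∀ {L V} (A : Alg L) → (V → Alg.Carrier A) → Fm V L → Alg.Carrier A
eval A v (var x)    = v x
eval A v (join a b) = Alg._∨_ A (eval A v a) (eval A v b)
eval A v (meet a b) = Alg.∧op A (eval A v a) (eval A v b)
eval A v (mul a b)  = Alg._*_ A (eval A v a) (eval A v b)
eval A v zer        = Alg.𝟎 A
eval A v one        = Alg.𝟏 A

module _ {L : Lang} (A : Alg L) where
  open Alg A

  _≤_ : Carrier → Carrier → Set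
  a ≤ b = (a ∨ b) ≡ b

  record IsMsl (σ : Sig) : Set where
    field
      ∨-assoc : ∀ x y z → ((x ∨ y) ∨ z) ≡ (x ∨ (y ∨ z))
      ∨-comm  : ∀ x y → (x ∨ y) ≡ (y ∨ x)
      ∨-idem  : ∀ x → (x ∨ x) ≡ x
      *-assoc : ∀ x y z → ((x * y) * z) ≡ (x * (y * z))
      *-identityˡ : ∀ x → (𝟏 * x) ≡ x
      *-identityʳ : ∀ x → (x * 𝟏) ≡ x
      *-distribˡ-∨ : ∀ x y z → (x * (y ∨ z)) ≡ ((x * y) ∨ (x * z))
      *-distribʳ-∨ : ∀ x y z → ((y ∨ z) * x) ≡ ((y * x) ∨ (z * x))
      ax-e  : Sig.e σ  ≡ true → ∀ x y → (x * y) ≡ (y * x)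
      ax-wl : Sig.wl σ ≡ true → ∀ x → x ≤ 𝟏
      ax-wr : Sig.wr σ ≡ true → ∀ x → 𝟎 ≤ x
      ax-c  : Sig.c σ  ≡ true → ∀ x → x ≤ (x * x)

record IsLatticeReduct (A : Alg lat) : Set where
  open Alg A
  _∧_ : Carrier → Carrier → Carrier
  _∧_ = ∧op
  field
    ∨-assoc : ∀ x y z → ((x ∨ y) ∨ z) ≡ (x ∨ (y ∨ z))
    ∨-comm  : ∀ x y → (x ∨ y) ≡ (y ∨ x)
    ∨-idem  : ∀ x → (x ∨ x) ≡ x
    ∧-assoc : ∀ x y z → ((x ∧ y) ∧ z) ≡ (x ∧ (y ∧ z))
    ∧-comm  : ∀ x y → (x ∧ y) ≡ (y ∧ x)
    ∧-idem  : ∀ x → (x ∧ x) ≡ x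
    ∨-absorbs-∧ : ∀ x y → (x ∨ (x ∧ y)) ≡ x
    ∧-absorbs-∨ : ∀ x y → (x ∧ (x ∨ y)) ≡ x

M : (L : Lang) → Sig → Alg L → Set
M sl  σ A = IsMsl A σ
M lat σ A = IsLatticeReduct A × IsMsl A σ

FmSet : Lang → Set₁
FmSet L = Form L → Set

EqSet : Lang → Set₁
EqSet L = Eqn L → Set

substSet : ∀ {L} → (ℕ → Form L) → FmSet L → FmSet L
substSet s Γ ψ = ∃ λ χ → Γ χ × (ψ ≡ subst s χ)

record HilbertSystem (L : Lang) : Set₁ where
  field
    _⊢_    : FmSet L → Form L → Set
    refl⊢  : ∀ {Γ φ} → Γ φ → Γ ⊢ φ
    mono⊢  : ∀ {Γ Δ φ} → (∀ ψ → Γ ψ → Δ ψ) → Γ ⊢ φ → Δ ⊢ φ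
    cut⊢   : ∀ {Γ Δ φ} → (∀ ψ → Δ ψ → Γ ⊢ ψ) → Δ ⊢ φ → Γ ⊢ φ
    struct⊢ : ∀ {Γ φ} (s : ℕ → Form L) → Γ ⊢ φ → substSet s Γ ⊢ subst s φ

Holds : ∀ {L} (A : Alg L) → (ℕ → Alg.Carrier A) → Eqn L → Set
Holds A v (φ , ψ) = eval A v φ ≡ eval A v ψ

_⊨[_]_ : ∀ {L} → EqSet L → (Alg L → Set) → Eqn L → Set₁
E ⊨[ K ] ε = ∀ A → K A → ∀ (v : ℕ → Alg.Carrier A) →
             (∀ e → E e → Holds A v e) → Holds A v ε

-- Translations given by schemas.
-- τ : a finite list of equations δᵢ(x) ≈ εᵢ(x) in ONE variable (⊤).
-- ρ : a finite list of formulas Δⱼ(x,y) in TWO variables (Bool).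

TauSchema : Lang → Set
TauSchema L = List (Fm ⊤ L × Fm ⊤ L)

RhoSchema : Lang → Set
RhoSchema L = List (Fm Bool L)

τ : ∀ {L} → TauSchema L → Form L → List (Eqn L)
τ T φ = map (λ { (d , e) → subst (λ _ → φ) d , subst (λ _ → φ) e }) T

ρ : ∀ {L} → RhoSchema L → Eqn L → List (Form L)
ρ R (φ , ψ) = map (subst (λ { true → φ ; false → ψ })) R

τSet : ∀ {L} → TauSchema L → FmSet L → EqSet L
τSet T Γ e = ∃ λ φ → Γ φ × e ∈ τ T φ

τρ : ∀ {L} → TauSchema L → RhoSchema L → Eqn L → EqSet L
τρ T R ε e = ∃ λ φ → φ ∈ ρ R ε × e ∈ τ T φ

⟦_⟧ : ∀ {L} → Eqn L → EqSet L
⟦ ε ⟧ e = e ≡ ε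

record IsEASvia {L : Lang} (K : Alg L → Set) (H : HilbertSystem L)
                (T : TauSchema L) (R : RhoSchema L) : Set₁ where
  open HilbertSystem H
  field
    sound    : ∀ Γ φ → Γ ⊢ φ → ∀ e → e ∈ τ T φ → τSet T Γ ⊨[ K ] e
    complete : ∀ Γ φ → (∀ e → e ∈ τ T φ → τSet T Γ ⊨[ K ] e) → Γ ⊢ φ
    eq→τρ    : ∀ ε e → τρ T R ε e → ⟦ ε ⟧ ⊨[ K ] e
    τρ→eq    : ∀ ε → τρ T R ε ⊨[ K ] ε

IsEAS : ∀ {L} → (Alg L → Set) → Set₁
IsEAS {L} K = Σ (HilbertSystem L) λ H →
              Σ (TauSchema L) λ T → Σ (RhoSchema L) λ R → IsEASvia K H T R

-- The two-element algebra 𝟚 = ⟨{0,1}, ∨, ∧, ∧, 0, 1⟩ lies in every class M̊_σ. Its term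
-- functions are monotone, so any term r(x, y) takes at x = 0, y = 1 the same value as at
-- x = y = k for the constant k it evaluates to. Hence in 𝟚 the equations τ(ρ(x ≈ y)),
-- evaluated at x = 0, y = 1, reduce to instances of τ(ρ(x ≈ x)), which hold because
-- x ≈ x does; yet x ≈ y fails there, contradicting the interderivability of ε and τ(ρ(ε)).
module Submission where

open import Defs hiding (_≤_)
open import Data.Product using (_×_; _,_)
open import Relation.Nullary using (¬_)

open import Data.Bool using (Bool; true; false; _∨_; _∧_; _≤_; b≤b; f≤t)
open import Data.Bool.Properties
open import Data.Nat using (ℕ; zero; suc)
open import Data.Unit using (tt)
open import Data.List.Membership.Propositional using (_∈_)
open import Data.List.Membership.Propositional.Properties using (∈-map⁺; ∈-map⁻)
open import Relation.Binary.PropositionalEquality using (_≡_; refl; sym; trans; cong; cong₂)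
open Relation.Binary.PropositionalEquality.≡-Reasoning

eval-subst : ∀ {L V W} (A : Alg L) (v : W → Alg.Carrier A) (s : V → Fm W L) (t : Fm V L) →
             eval A v (subst s t) ≡ eval A (λ x → eval A v (s x)) t
eval-subst A v s (var x)    = refl
eval-subst A v s (join a b) = cong₂ (Alg._∨_ A) (eval-subst A v s a) (eval-subst A v s b)
eval-subst A v s (meet a b) = cong₂ (Alg.∧op A) (eval-subst A v s a) (eval-subst A v s b)
eval-subst A v s (mul a b)  = cong₂ (Alg._*_ A) (eval-subst A v s a) (eval-subst A v s b)
eval-subst A v s zer        = refl
eval-subst A v s one        = refl

eval-cong : ∀ {L V} (A : Alg L) {u u′ : V → Alg.Carrier A} → (∀ x → u x ≡ u′ x) →
            (t : Fm V L) → eval A u t ≡ eval A u′ t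
eval-cong A u≗u′ (var x)    = u≗u′ x
eval-cong A u≗u′ (join a b) = cong₂ (Alg._∨_ A) (eval-cong A u≗u′ a) (eval-cong A u≗u′ b)
eval-cong A u≗u′ (meet a b) = cong₂ (Alg.∧op A) (eval-cong A u≗u′ a) (eval-cong A u≗u′ b)
eval-cong A u≗u′ (mul a b)  = cong₂ (Alg._*_ A) (eval-cong A u≗u′ a) (eval-cong A u≗u′ b)
eval-cong A u≗u′ zer        = refl
eval-cong A u≗u′ one        = refl

τ-transfer : ∀ {L} (A : Alg L) (T : TauSchema L) {v w : ℕ → Alg.Carrier A} {φ ψ : Form L} →
             eval A v φ ≡ eval A w ψ →
             (∀ e → e ∈ τ T ψ → Holds A w e) → ∀ e → e ∈ τ T φ → Holds A v e
τ-transfer A T {v} {w} {φ} {ψ} φ≡ψ τψ-holds e e∈τφ with ∈-map⁻ _ e∈τφ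
... | (d , d′) , dd′∈T , refl =
  trans (same-value d) (trans (τψ-holds _ (∈-map⁺ _ dd′∈T)) (sym (same-value d′)))
  where
  same-value : ∀ d → eval A v (subst (λ _ → φ) d) ≡ eval A w (subst (λ _ → ψ) d)
  same-value d = begin
    eval A v (subst (λ _ → φ) d)   ≡⟨ eval-subst A v _ d ⟩
    eval A (λ _ → eval A v φ) d    ≡⟨ cong (λ a → eval A (λ _ → a) d) φ≡ψ ⟩
    eval A (λ _ → eval A w ψ) d    ≡⟨ sym (eval-subst A w _ d) ⟩
    eval A w (subst (λ _ → ψ) d)   ∎

𝟚∧ : (L : Lang) → MeetOp L Bool
𝟚∧ sl  = tt
𝟚∧ lat = _∧_

𝟚 : (L : Lang) → Alg L
𝟚 L = record { Carrier = Bool ; _∨_ = _∨_ ; ∧op = 𝟚∧ L ; _*_ = _∧_ ; 𝟎 = false ; 𝟏 = true }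

𝟚-isMsl : ∀ {L} σ → IsMsl (𝟚 L) σ
𝟚-isMsl σ = record
  { ∨-assoc      = ∨-assoc
  ; ∨-comm       = ∨-comm
  ; ∨-idem       = ∨-idem
  ; *-assoc      = ∧-assoc
  ; *-identityˡ  = ∧-identityˡ
  ; *-identityʳ  = ∧-identityʳ
  ; *-distribˡ-∨ = ∧-distribˡ-∨
  ; *-distribʳ-∨ = ∧-distribʳ-∨
  ; ax-e         = λ _ → ∧-comm
  ; ax-wl        = λ _ → ∨-zeroʳ
  ; ax-wr        = λ _ _ → refl
  ; ax-c         = λ _ → λ { false → refl ; true → refl }
  }

𝟚-isLatticeReduct : IsLatticeReduct (𝟚 lat)
𝟚-isLatticeReduct = record
  { ∨-assoc     = ∨-assoc
  ; ∨-comm      = ∨-comm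
  ; ∨-idem      = ∨-idem
  ; ∧-assoc     = ∧-assoc
  ; ∧-comm      = ∧-comm
  ; ∧-idem      = ∧-idem
  ; ∨-absorbs-∧ = ∨-abs-∧
  ; ∧-absorbs-∨ = ∧-abs-∨
  }

𝟚∈M : ∀ L σ → M L σ (𝟚 L)
𝟚∈M sl  σ = 𝟚-isMsl σ
𝟚∈M lat σ = 𝟚-isLatticeReduct , 𝟚-isMsl σ

∨-mono-≤ : ∀ {a a′ b b′} → a ≤ a′ → b ≤ b′ → a ∨ b ≤ a′ ∨ b′
∨-mono-≤ {true}  b≤b _   = b≤b
∨-mono-≤ {false} b≤b b≤b′ = b≤b′
∨-mono-≤ f≤t _            = ≤-maximum _

∧-mono-≤ : ∀ {a a′ b b′} → a ≤ a′ → b ≤ b′ → a ∧ b ≤ a′ ∧ b′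
∧-mono-≤ {true}  b≤b b≤b′ = b≤b′
∧-mono-≤ {false} b≤b _    = b≤b
∧-mono-≤ f≤t _            = ≤-minimum _

eval-𝟚-mono : ∀ {L V} {u u′ : V → Bool} → (∀ x → u x ≤ u′ x) →
              (t : Fm V L) → eval (𝟚 L) u t ≤ eval (𝟚 L) u′ t
eval-𝟚-mono u≤u′ (var x)    = u≤u′ x
eval-𝟚-mono u≤u′ (join a b) = ∨-mono-≤ (eval-𝟚-mono u≤u′ a) (eval-𝟚-mono u≤u′ b)
eval-𝟚-mono u≤u′ (meet a b) = ∧-mono-≤ (eval-𝟚-mono u≤u′ a) (eval-𝟚-mono u≤u′ b)
eval-𝟚-mono u≤u′ (mul a b)  = ∧-mono-≤ (eval-𝟚-mono u≤u′ a) (eval-𝟚-mono u≤u′ b)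
eval-𝟚-mono u≤u′ zer        = b≤b
eval-𝟚-mono u≤u′ one        = b≤b

eval-𝟚-const : ∀ {L V} (u : V → Bool) (t : Fm V L) →
               eval (𝟚 L) (λ _ → eval (𝟚 L) u t) t ≡ eval (𝟚 L) u t
eval-𝟚-const {L} u t with eval (𝟚 L) u t in eq
... | false = ≤-antisym (≤-trans (eval-𝟚-mono (λ x → ≤-minimum (u x)) t) (≤-reflexive eq))
                        (≤-minimum _)
... | true  = ≤-antisym (≤-maximum _)
                        (≤-trans (≤-reflexive (sym eq)) (eval-𝟚-mono (λ x → ≤-maximum (u x)) t))

eval-𝟚-subst-const : ∀ {L V W} (v : W → Bool) (s : V → Fm W L) (t : Fm V L) →
                     eval (𝟚 L) (λ _ → eval (𝟚 L) v (subst s t)) t ≡ eval (𝟚 L) v (subst s t)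
eval-𝟚-subst-const {L} v s t rewrite eval-subst (𝟚 L) v s t = eval-𝟚-const _ t

eval-𝟚-diagonal : ∀ {L V} (v : ℕ → Bool) (s s₀ : V → Fm ℕ L) → (∀ x → s₀ x ≡ var 0) →
                  (t : Fm V L) →
                  eval (𝟚 L) v (subst s t) ≡ eval (𝟚 L) (λ _ → eval (𝟚 L) v (subst s t)) (subst s₀ t)
eval-𝟚-diagonal {L} v s s₀ s₀≡x₀ t = begin
  eval (𝟚 L) v (subst s t)                 ≡⟨ sym (eval-𝟚-subst-const v s t) ⟩
  eval (𝟚 L) (λ _ → k) t                   ≡⟨ eval-cong (𝟚 L) (λ x → cong (eval (𝟚 L) (λ _ → k)) (sym (s₀≡x₀ x))) t ⟩
  eval (𝟚 L) (λ x → eval (𝟚 L) (λ _ → k) (s₀ x)) t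
                                            ≡⟨ sym (eval-subst (𝟚 L) (λ _ → k) s₀ t) ⟩
  eval (𝟚 L) (λ _ → k) (subst s₀ t)        ∎
  where
  k : Bool
  k = eval (𝟚 L) v (subst s t)

𝟚∈K⇒¬IsEAS : ∀ {L} (K : Alg L → Set) → K (𝟚 L) → ¬ IsEAS K
𝟚∈K⇒¬IsEAS {L} K 𝟚∈K (H , T , R , eas) = x₀≉x₁ (τρ→eq (var 0 , var 1) (𝟚 L) 𝟚∈K separate τρ-holds)
  where
  open IsEASvia eas

  separate : ℕ → Bool
  separate zero    = false
  separate (suc _) = true

  x₀≉x₁ : ¬ Holds (𝟚 L) separate (var 0 , var 1)
  x₀≉x₁ ()

  τρ-diagonal-holds : ∀ k {ψ} → ψ ∈ ρ R (var 0 , var 0) → ∀ e → e ∈ τ T ψ → Holds (𝟚 L) (λ _ → k) e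
  τρ-diagonal-holds k {ψ} ψ∈ρ e e∈τψ =
    eq→τρ (var 0 , var 0) e (ψ , ψ∈ρ , e∈τψ) (𝟚 L) 𝟚∈K (λ _ → k) λ { _ refl → refl }

  τρ-holds : ∀ e → τρ T R (var 0 , var 1) e → Holds (𝟚 L) separate e
  τρ-holds e (φ , φ∈ρ , e∈τφ) with ∈-map⁻ _ φ∈ρ
  ... | r , r∈R , refl =
    τ-transfer (𝟚 L) T (eval-𝟚-diagonal separate _ _ (λ { true → refl ; false → refl }) r)
               (τρ-diagonal-holds _ (∈-map⁺ _ r∈R)) e e∈τφ

theorem27 : (σ : Sig) → ¬ IsEAS (M sl σ) × ¬ IsEAS (M lat σ)
theorem27 σ = 𝟚∈K⇒¬IsEAS (M sl σ) (𝟚∈M sl σ) , 𝟚∈K⇒¬IsEAS (M lat σ) (𝟚∈M lat σ)
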